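{- Let $X$ be a set of $n$ cards, $a,b,c$ positive integers with $a+b+c=n$, and suppose Alice's $(a,b,c)$-strategy is $\gamma$-equitable. Then: (1) the strategy is weakly $1$-secure against Cathy if and only if for every announcement index $i$, every $H_C\in\binom{X}{c}$ with $\mathcal{P}(H_C,i)\neq\emptyset$, and every $x\in X\setminus H_C$, \[1\le |\{H_A\in\mathcal{P}(H_C,i): x\in H_A\}|\le |\mathcal{P}(H_C,i)|-1;\] (2) the strategy is perfectly $1$-secure against Cathy if and only if for every announcement index $i$, every $H_C\in\binom{X}{c}$ with $\mathcal{P}(H_C,i)\neq\emptyset$, and every $x\in X\setminus H_C$, \[|\{H_A\in\mathcal{P}(H_C,i): x\in H_A\}| = \frac{a\,|\mathcal{P}(H_C,i)|}{a+b}.\]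
   Context: An $(a,b,c)$-deal is a uniformly random partition of $X$ into Alice's hand $H_A$ ($a$ cards), Bob's hand $H_B$ ($b$ cards) and Cathy's hand $H_C$ ($c$ cards). $\binom{X}{t}$ denotes the set of $t$-subsets of $X$. An announcement is a subset of $\binom{X}{a}$. An $(a,b,c)$-strategy consists of announcements $\mathcal{A}_1,\dots,\mathcal{A}_m$ covering $\binom{X}{a}$ together with, for each $H_A$, a probability distribution $p_{H_A}$ with positive values on $g(H_A)=\{i : H_A\in\mathcal{A}_i\}$; after the deal Alice broadcasts an index $i$ chosen according to $p_{H_A}$. The strategy is $\gamma$-equitable if $|g(H_A)|=\gamma$ for all $H_A$ and every $p_{H_A}$ is uniform. For $H\subseteq X$, $\mathcal{P}(H,i)=\{H_A\in\mathcal{A}_i : H_A\cap H=\emptyset\}$. The strategy is weakly $1$-secure against Cathy if for every $i$, every $H_C\in\binom{X}{c}$ with $\mathcal{P}(H_C,i)\ne\emptyset$ and every $x\in X\setminus H_C$, $0<\Pr[x\in H_A\mid i,H_C]<1$; it is perfectly $1$-secure against Cathy if under the same quantifiers $\Pr[x\in H_A\mid i,H_C]=a/(a+b)$. Probabilities are over the random deal and Alice's random choice. -}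

module Defs where

open import Data.Bool using (Bool; true; false; _∧_; _∨_; not; if_then_else_)
open import Data.Nat using (ℕ; zero; suc; _≡ᵇ_; _≤_; _∸_)
import Data.Nat
open import Data.Fin using (Fin)
open import Data.Vec using (Vec; []; _∷_; lookup)
open import Data.List using (List; []; _∷_; map; filter; length; allFin; concatMap; foldr)
open import Data.Product using (_×_; _,_; proj₁; proj₂; ∃-syntax)
open import Data.Integer using (+_)
open import Data.Rational using (ℚ; 0ℚ; 1ℚ; _+_; _*_; _÷_; _/_; _<_; ≢-nonZero)
open import Data.Rational.Properties using (_≟_)
open import Data.Fin.Subset using (Subset; ∣_∣; _∈_; _∉_)
open import Relation.Nullary using (yes; no)
open import Relation.Binary.PropositionalEquality using (_≡_; _≢_)

allSubsets : (n : ℕ) → List (Subset n)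
allSubsets zero = [] ∷ []
allSubsets (suc n) = concatMap (λ s → (false ∷ s) ∷ (true ∷ s) ∷ []) (allSubsets n)

_∈ᵇ_ : ∀ {n} → Fin n → Subset n → Bool
x ∈ᵇ H = lookup H x

_=ˢ_ : ∀ {n} → Subset n → Subset n → Bool
[] =ˢ [] = true
(x ∷ xs) =ˢ (y ∷ ys) = ((x ∧ y) ∨ (not x ∧ not y)) ∧ (xs =ˢ ys)

disjointᵇ : ∀ {n} → Subset n → Subset n → Bool
disjointᵇ [] [] = true
disjointᵇ (x ∷ xs) (y ∷ ys) = not (x ∧ y) ∧ disjointᵇ xs ys

coverᵇ : ∀ {n} → Subset n → Subset n → Subset n → Bool
coverᵇ [] [] [] = true
coverᵇ (x ∷ xs) (y ∷ ys) (z ∷ zs) = (x ∨ y ∨ z) ∧ coverᵇ xs ys zs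

sumℚ : List ℚ → ℚ
sumℚ = foldr _+_ 0ℚ

-- p / q as a rational (0 when q = 0; only used with q > 0)
frac : ℕ → ℕ → ℚ
frac p zero = 0ℚ
frac p (suc q) = (+ p) / suc q

Deal : ℕ → Set
Deal n = Subset n × Subset n × Subset n

HA HB HC : ∀ {n} → Deal n → Subset n
HA d = proj₁ d
HB d = proj₁ (proj₂ d)
HC d = proj₂ (proj₂ d)

isDealᵇ : ∀ {n} → ℕ → ℕ → ℕ → Deal n → Bool
isDealᵇ a b c d =
  (∣ HA d ∣ ≡ᵇ a) ∧ (∣ HB d ∣ ≡ᵇ b) ∧ (∣ HC d ∣ ≡ᵇ c)
  ∧ disjointᵇ (HA d) (HB d) ∧ disjointᵇ (HA d) (HC d) ∧ disjointᵇ (HB d) (HC d)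
  ∧ coverᵇ (HA d) (HB d) (HC d)

deals : (n a b c : ℕ) → List (Deal n)
deals n a b c =
  filter (λ d → isDealᵇ a b c d ≟ᵇ true)
    (concatMap (λ A → concatMap (λ B → map (λ C → (A , B , C)) (allSubsets n)) (allSubsets n)) (allSubsets n))
  where
  open import Data.Bool.Properties renaming (_≟_ to _≟ᵇ_)

record Strategy (n a : ℕ) : Set where
  field
    m     : ℕ
    -- announcement i, as the indicator of a set of a-subsets of X
    ann   : Fin m → Subset n → Bool
    ann-⊆ : ∀ i H → ann i H ≡ true → ∣ H ∣ ≡ a
    cover : ∀ H → ∣ H ∣ ≡ a → ∃[ i ] (ann i H ≡ true)
    -- Alice's distribution p_{H_A} on g(H_A) = { i | H_A ∈ A_i }
    p     : Subset n → Fin m → ℚ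
    p-pos : ∀ H i → ann i H ≡ true → 0ℚ < p H i
    p-out : ∀ H i → ann i H ≡ false → p H i ≡ 0ℚ
    p-sum : ∀ H → ∣ H ∣ ≡ a → sumℚ (map (p H) (allFin m)) ≡ 1ℚ

  g : Subset n → List (Fin m)
  g H = filter (λ i → ann i H ≟ᵇ true) (allFin m)
    where open import Data.Bool.Properties renaming (_≟_ to _≟ᵇ_)

open Strategy public

Equitable : ∀ {n a} → ℕ → Strategy n a → Set
Equitable {n} {a} γ S =
  (∀ H → ∣ H ∣ ≡ a → length (g S H) ≡ γ)
  × (∀ H i j → ann S i H ≡ true → ann S j H ≡ true → p S H i ≡ p S H j)

-- Probability space: outcome = (deal, announced index); the deal is uniform
-- over all (a,b,c)-deals and, given the deal, index i has probability p_{H_A}(i).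

uniformWeight : ℕ → ℚ
uniformWeight N = frac 1 N

Pr : ∀ {n a} (b c : ℕ) (S : Strategy n a) → (Deal n → Fin (m S) → Bool) → ℚ
Pr {n} {a} b c S E =
  sumℚ (map (λ d → sumℚ (map (λ i → if E d i then uniformWeight (length (deals n a b c)) * p S (HA d) i else 0ℚ)
                             (allFin (m S))))
            (deals n a b c))

-- conditional probability Pr[E | F] (defined as 0 when Pr[F] = 0)
CondPr : ∀ {n a} (b c : ℕ) (S : Strategy n a) → (E F : Deal n → Fin (m S) → Bool) → ℚ
CondPr b c S E F with Pr b c S F ≟ 0ℚ
... | yes _ = 0ℚ
... | no nz = _÷_ (Pr b c S (λ d i → E d i ∧ F d i)) (Pr b c S F) {{≢-nonZero nz}}

PrIn : ∀ {n a} (b c : ℕ) (S : Strategy n a) → Fin (m S) → Subset n → Fin n → ℚ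
PrIn b c S i H x =
  CondPr b c S (λ d j → x ∈ᵇ HA d) (λ d j → eqFin j i ∧ (HC d =ˢ H))
  where
  open import Data.Fin using () renaming (_≟_ to _≟ᶠ_)
  open import Relation.Nullary.Decidable using (⌊_⌋)
  eqFin : Fin (m S) → Fin (m S) → Bool
  eqFin j k = ⌊ j ≟ᶠ k ⌋

𝒫 : ∀ {n a} (S : Strategy n a) → Subset n → Fin (m S) → List (Subset n)
𝒫 {n} S H i = filter (λ A → (ann S i A ∧ disjointᵇ A H) ≟ᵇ true) (allSubsets n)
  where open import Data.Bool.Properties renaming (_≟_ to _≟ᵇ_)

count𝒫 : ∀ {n a} (S : Strategy n a) → Subset n → Fin (m S) → Fin n → ℕ
count𝒫 S H i x = length (filter (λ A → (x ∈ᵇ A) ≟ᵇ true) (𝒫 S H i))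
  where open import Data.Bool.Properties renaming (_≟_ to _≟ᵇ_)

Weakly1Secure : ∀ {n a} (b c : ℕ) → Strategy n a → Set
Weakly1Secure {n} b c S =
  ∀ (i : Fin (m S)) (H : Subset n) → ∣ H ∣ ≡ c → 𝒫 S H i ≢ [] →
  ∀ (x : Fin n) → x ∉ H → (0ℚ < PrIn b c S i H x) × (PrIn b c S i H x < 1ℚ)

Perfectly1Secure : ∀ {n a} (b c : ℕ) → Strategy n a → Set
Perfectly1Secure {n} {a} b c S =
  ∀ (i : Fin (m S)) (H : Subset n) → ∣ H ∣ ≡ c → 𝒫 S H i ≢ [] →
  ∀ (x : Fin n) → x ∉ H → PrIn b c S i H x ≡ frac a (a Data.Nat.+ b)

-- Once Alice has announced i and Cathy holds H, the deal is determined by Alice's hand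
-- H_A (Bob holds the remaining cards), every deal is equally likely, and by equitability
-- Alice announces i from any H_A ∈ 𝒜_i with the same probability 1/γ.  Hence Cathy's
-- posterior on H_A is uniform on 𝒫(H, i), so Pr[x ∈ H_A | i, H] · |𝒫(H, i)| is the number
-- of hands in 𝒫(H, i) containing x.  Both criteria follow from this identity by
-- rational arithmetic.
module Submission where

open import Data.Nat as ℕ using (ℕ; zero; suc; _+_; _*_; _≤_; _∸_; _≡ᵇ_; NonZero; s≤s)
import Data.Nat.Properties as ℕ
open import Data.Integer as ℤ using (+_)
import Data.Integer.Properties as ℤ
import Data.Rational
open import Data.Rational as ℚ using (ℚ; 0ℚ; 1ℚ; 1/_; toℚᵘ; Positive)
import Data.Rational.Properties as ℚ
open import Data.Rational.Unnormalised as ℚᵘ using (mkℚᵘ; _≃_; *≡*; *<*)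
import Data.Rational.Unnormalised.Properties as ℚᵘ
open import Data.Bool using (Bool; true; false; _∧_; if_then_else_)
open import Data.Bool.Properties using (if-∧; if-eta; if-swap-then; T-≡) renaming (_≟_ to _≟ᵇ_)
open import Data.Vec using ([]; _∷_)
open import Data.List using (List; []; _∷_; map; filter; length; concatMap; _++_; allFin; tabulate)
import Data.List.Properties as List
import Data.List.Relation.Unary.All as All
open import Data.Fin using (Fin; _≟_) renaming (zero to fzero; suc to fsuc)
open import Data.Fin.Subset using (Subset; ∣_∣; _∉_; ∁; _∪_)
open import Data.Product using (_×_; _,_; proj₁; proj₂)
open import Function.Bundles using (_⇔_; mk⇔; Equivalence)
open import Relation.Nullary using (yes; no; contradiction)
open import Relation.Nullary.Decidable using (⌊_⌋; ⌊⌋-map′)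
open import Relation.Binary.PropositionalEquality
open import Algebra.Bundles using (CommutativeMonoid)
open import Algebra.Properties.CommutativeSemigroup (CommutativeMonoid.commutativeSemigroup ℚ.*-1-commutativeMonoid)
  using (x∙yz≈y∙xz)
open import Defs

toℚ : ℕ → ℚ
toℚ k = + k ℚ./ 1

toℚ-pos : ∀ k .{{_ : NonZero k}} → Positive (toℚ k)
toℚ-pos (suc k) = ℚ.normalize-pos (suc k) 1

uniformWeight-pos : ∀ N .{{_ : NonZero N}} → Positive (uniformWeight N)
uniformWeight-pos (suc N) = ℚ.normalize-pos 1 (suc N)

toℚᵘ-frac : ∀ k d → toℚᵘ (frac k (suc d)) ≃ mkℚᵘ (+ k) d
toℚᵘ-frac k d = ℚ.toℚᵘ-fromℚᵘ (mkℚᵘ (+ k) d)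

toℚ-suc : ∀ k → toℚ (suc k) ≡ 1ℚ ℚ.+ toℚ k
toℚ-suc k = ℚ.toℚᵘ-injective (begin
  toℚᵘ (toℚ (suc k))            ≈⟨ toℚᵘ-frac (suc k) 0 ⟩
  mkℚᵘ (+ suc k) 0               ≈⟨ *≡* (cong (λ z → (+ 1 ℤ.+ z) ℤ.* + 1) (ℤ.*-identityʳ (+ k))) ⟨
  ℚᵘ.1ℚᵘ ℚᵘ.+ mkℚᵘ (+ k) 0      ≈⟨ ℚᵘ.+-congʳ ℚᵘ.1ℚᵘ (toℚᵘ-frac k 0) ⟨
  toℚᵘ 1ℚ ℚᵘ.+ toℚᵘ (toℚ k)     ≈⟨ ℚ.toℚᵘ-homo-+ 1ℚ (toℚ k) ⟨
  toℚᵘ (1ℚ ℚ.+ toℚ k)           ∎)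
  where open ℚᵘ.≃-Reasoning

frac-* : ∀ k s l → frac (k * l) s ≡ frac k s ℚ.* toℚ l
frac-* k zero    l = sym (ℚ.*-zeroˡ (toℚ l))
frac-* k (suc d) l = ℚ.toℚᵘ-injective (begin
  toℚᵘ (frac (k * l) (suc d))                ≈⟨ toℚᵘ-frac (k * l) d ⟩
  mkℚᵘ (+ (k * l)) d
    ≈⟨ *≡* (cong₂ ℤ._*_ (ℤ.pos-* k l) (cong (λ e → + suc e) (ℕ.*-identityʳ d))) ⟩
  mkℚᵘ (+ k) d ℚᵘ.* mkℚᵘ (+ l) 0             ≈⟨ ℚᵘ.*-cong (toℚᵘ-frac k d) (toℚᵘ-frac l 0) ⟨
  toℚᵘ (frac k (suc d)) ℚᵘ.* toℚᵘ (toℚ l)    ≈⟨ ℚ.toℚᵘ-homo-* (frac k (suc d)) (toℚ l) ⟨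
  toℚᵘ (frac k (suc d) ℚ.* toℚ l)            ∎)
  where open ℚᵘ.≃-Reasoning

toℚ-<⇔ : ∀ {k l} → toℚ k ℚ.< toℚ l ⇔ k ℕ.< l
toℚ-<⇔ {k} {l} = mk⇔
  (λ lt → ℤ.drop‿+<+ (subst₂ ℤ._<_ (ℤ.*-identityʳ (+ k)) (ℤ.*-identityʳ (+ l))
            (ℚᵘ.drop-*<* (ℚᵘ.<-respˡ-≃ (toℚᵘ-frac k 0) (ℚᵘ.<-respʳ-≃ (toℚᵘ-frac l 0) (ℚ.toℚᵘ-mono-< lt))))))
  (λ lt → ℚ.toℚᵘ-cancel-< (ℚᵘ.<-respˡ-≃ (ℚᵘ.≃-sym (toℚᵘ-frac k 0)) (ℚᵘ.<-respʳ-≃ (ℚᵘ.≃-sym (toℚᵘ-frac l 0))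
            (*<* (subst₂ ℤ._<_ (sym (ℤ.*-identityʳ (+ k))) (sym (ℤ.*-identityʳ (+ l))) (ℤ.+<+ lt))))))

*-cancelʳ-pos : ∀ r .{{_ : Positive r}} {x y : ℚ} → x ℚ.* r ≡ y ℚ.* r → x ≡ y
*-cancelʳ-pos r e = ℚ.≤-antisym (ℚ.*-cancelʳ-≤-pos r (ℚ.≤-reflexive e)) (ℚ.*-cancelʳ-≤-pos r (ℚ.≤-reflexive (sym e)))

*-cancelˡ-pos : ∀ r .{{_ : Positive r}} {x y : ℚ} → r ℚ.* x ≡ r ℚ.* y → x ≡ y
*-cancelˡ-pos r {x} {y} e = *-cancelʳ-pos r (trans (ℚ.*-comm x r) (trans e (ℚ.*-comm r y)))

*-if-0 : ∀ k b {x : ℚ} → k ℚ.* (if b then x else 0ℚ) ≡ (if b then k ℚ.* x else 0ℚ)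
*-if-0 k true  = refl
*-if-0 k false = ℚ.*-zeroʳ k

private variable
  A B C : Set
  n : ℕ

sumℚ-cong : {f g : A → ℚ} (xs : List A) → (∀ x → f x ≡ g x) → sumℚ (map f xs) ≡ sumℚ (map g xs)
sumℚ-cong []       e = refl
sumℚ-cong (x ∷ xs) e = cong₂ ℚ._+_ (e x) (sumℚ-cong xs e)

sumℚ-++ : (f : A → ℚ) (xs ys : List A) → sumℚ (map f (xs ++ ys)) ≡ sumℚ (map f xs) ℚ.+ sumℚ (map f ys)
sumℚ-++ f []       ys = sym (ℚ.+-identityˡ _)
sumℚ-++ f (x ∷ xs) ys = trans (cong (f x ℚ.+_) (sumℚ-++ f xs ys)) (sym (ℚ.+-assoc (f x) _ _))

sumℚ-concatMap : (g : A → List B) (f : B → ℚ) (xs : List A) →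
  sumℚ (map f (concatMap g xs)) ≡ sumℚ (map (λ x → sumℚ (map f (g x))) xs)
sumℚ-concatMap g f []       = refl
sumℚ-concatMap g f (x ∷ xs) =
  trans (sumℚ-++ f (g x) (concatMap g xs)) (cong (sumℚ (map f (g x)) ℚ.+_) (sumℚ-concatMap g f xs))

sumℚ-triples : (f : A × B × C → ℚ) (xs : List A) (ys : List B) (zs : List C) →
  sumℚ (map f (concatMap (λ x → concatMap (λ y → map (λ z → (x , y , z)) zs) ys) xs))
  ≡ sumℚ (map (λ x → sumℚ (map (λ y → sumℚ (map (λ z → f (x , y , z)) zs)) ys)) xs)
sumℚ-triples f xs ys zs =
  trans (sumℚ-concatMap _ f xs) (sumℚ-cong xs λ x →
    trans (sumℚ-concatMap _ f ys) (sumℚ-cong ys λ y →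
      cong sumℚ (sym (List.map-∘ zs))))

sumℚ-filter : (P : A → Bool) (f : A → ℚ) (xs : List A) →
  sumℚ (map f (filter (λ x → P x ≟ᵇ true) xs)) ≡ sumℚ (map (λ x → if P x then f x else 0ℚ) xs)
sumℚ-filter P f []       = refl
sumℚ-filter P f (x ∷ xs) with P x
... | true  = cong (f x ℚ.+_) (sumℚ-filter P f xs)
... | false = trans (sumℚ-filter P f xs) (sym (ℚ.+-identityˡ _))

*-distribˡ-sumℚ : (k : ℚ) (f : A → ℚ) (xs : List A) → k ℚ.* sumℚ (map f xs) ≡ sumℚ (map (λ x → k ℚ.* f x) xs)
*-distribˡ-sumℚ k f []       = ℚ.*-zeroʳ k
*-distribˡ-sumℚ k f (x ∷ xs) = trans (ℚ.*-distribˡ-+ k (f x) _) (cong (k ℚ.* f x ℚ.+_) (*-distribˡ-sumℚ k f xs))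

sumℚ-count : (P : A → Bool) (k : ℚ) (xs : List A) →
  sumℚ (map (λ x → if P x then k else 0ℚ) xs) ≡ toℚ (length (filter (λ x → P x ≟ᵇ true) xs)) ℚ.* k
sumℚ-count P k []       = sym (ℚ.*-zeroˡ k)
sumℚ-count P k (x ∷ xs) with P x
... | false = trans (ℚ.+-identityˡ _) (sumℚ-count P k xs)
... | true  = begin
  k ℚ.+ sumℚ (map (λ x → if P x then k else 0ℚ) xs)   ≡⟨ cong₂ ℚ._+_ (sym (ℚ.*-identityˡ k)) (sumℚ-count P k xs) ⟩
  1ℚ ℚ.* k ℚ.+ toℚ c ℚ.* k                          ≡⟨ ℚ.*-distribʳ-+ k 1ℚ (toℚ c) ⟨
  (1ℚ ℚ.+ toℚ c) ℚ.* k                               ≡⟨ cong (ℚ._* k) (toℚ-suc c) ⟨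
  toℚ (suc c) ℚ.* k                                  ∎
  where
  open ≡-Reasoning
  c = length (filter (λ x → P x ≟ᵇ true) xs)

≢[]⇒length-nonZero : {xs : List A} → xs ≢ [] → NonZero (length xs)
≢[]⇒length-nonZero {xs = []}    xs≢[] = contradiction refl xs≢[]
≢[]⇒length-nonZero {xs = _ ∷ _} _     = _

sumℚ-indicator : ∀ {m} (f : Fin m → ℚ) (i : Fin m) →
  sumℚ (map (λ j → if ⌊ j ≟ i ⌋ then f j else 0ℚ) (allFin m)) ≡ f i
sumℚ-indicator f i = trans (cong sumℚ (List.map-tabulate (λ j → j) (λ j → if ⌊ j ≟ i ⌋ then f j else 0ℚ))) (indicator f i)
  where
  zeros : ∀ m → sumℚ (tabulate {n = m} (λ _ → 0ℚ)) ≡ 0ℚ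
  zeros zero    = refl
  zeros (suc m) = trans (cong (0ℚ ℚ.+_) (zeros m)) (ℚ.+-identityʳ 0ℚ)
  indicator : ∀ {m} (f : Fin m → ℚ) (i : Fin m) → sumℚ (tabulate (λ j → if ⌊ j ≟ i ⌋ then f j else 0ℚ)) ≡ f i
  indicator {suc m} f fzero    = trans (cong (f fzero ℚ.+_) (zeros m)) (ℚ.+-identityʳ _)
  indicator {suc m} f (fsuc i) = trans (ℚ.+-identityˡ _) (trans (cong sumℚ (List.tabulate-cong λ j →
    cong (λ b → if b then f (fsuc j) else 0ℚ) (⌊⌋-map′ _ _ (j ≟ i)))) (indicator (λ j → f (fsuc j)) i))

-- Deals with a given hand for Cathy

bool-ext : ∀ {x y : Bool} → (x ≡ true → y ≡ true) → (y ≡ true → x ≡ true) → x ≡ y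
bool-ext {false} {false} _ _ = refl
bool-ext {false} {true}  _ g = g refl
bool-ext {true}          f _ = sym (f refl)

∧-≡-true : ∀ x {y} → x ∧ y ≡ true → x ≡ true × y ≡ true
∧-≡-true true e = refl , e

≡⇒≡ᵇ-true : ∀ {k l} → k ≡ l → (k ≡ᵇ l) ≡ true
≡⇒≡ᵇ-true {k} {l} e = Equivalence.to T-≡ (ℕ.≡⇒≡ᵇ k l e)

≡ᵇ-true⇒≡ : ∀ {k l} → (k ≡ᵇ l) ≡ true → k ≡ l
≡ᵇ-true⇒≡ {k} {l} e = ℕ.≡ᵇ⇒≡ k l (Equivalence.from T-≡ e)

=ˢ⇒≡ : (A B : Subset n) → A =ˢ B ≡ true → A ≡ B
=ˢ⇒≡ []          []          _ = refl
=ˢ⇒≡ (true ∷ A)  (true ∷ B)  e = cong (true ∷_) (=ˢ⇒≡ A B e)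
=ˢ⇒≡ (false ∷ A) (false ∷ B) e = cong (false ∷_) (=ˢ⇒≡ A B e)

=ˢ-refl : (A : Subset n) → A =ˢ A ≡ true
=ˢ-refl []          = refl
=ˢ-refl (true ∷ A)  = =ˢ-refl A
=ˢ-refl (false ∷ A) = =ˢ-refl A

sumℚ-=ˢ : ∀ n (f : Subset n → ℚ) (H : Subset n) →
  sumℚ (map (λ C → if C =ˢ H then f C else 0ℚ) (allSubsets n)) ≡ f H
sumℚ-=ˢ zero    f []      = ℚ.+-identityʳ (f [])
sumℚ-=ˢ (suc n) f (h ∷ H) =
  trans (sumℚ-concatMap _ _ (allSubsets n)) (trans (sumℚ-cong (allSubsets n) (extend h)) (sumℚ-=ˢ n (λ C → f (h ∷ C)) H))
  where
  extend : ∀ h C → sumℚ (map (λ C′ → if C′ =ˢ (h ∷ H) then f C′ else 0ℚ) ((false ∷ C) ∷ (true ∷ C) ∷ []))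
                   ≡ (if C =ˢ H then f (h ∷ C) else 0ℚ)
  extend true  C = trans (ℚ.+-identityˡ _) (ℚ.+-identityʳ _)
  extend false C = ℚ.+-identityʳ _

partition⇒≡∁∪ : (A B H : Subset n) → disjointᵇ A B ≡ true → disjointᵇ B H ≡ true → coverᵇ A B H ≡ true →
  B ≡ ∁ (A ∪ H)
partition⇒≡∁∪ []          []          []          _ _ _ = refl
partition⇒≡∁∪ (true ∷ A)  (false ∷ B) (_ ∷ H)     d e f = cong (false ∷_) (partition⇒≡∁∪ A B H d e f)
partition⇒≡∁∪ (false ∷ A) (true ∷ B)  (false ∷ H) d e f = cong (true ∷_) (partition⇒≡∁∪ A B H d e f)
partition⇒≡∁∪ (false ∷ A) (false ∷ B) (true ∷ H)  d e f = cong (false ∷_) (partition⇒≡∁∪ A B H d e f)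

disjointᵇ-∁∪ˡ : (A H : Subset n) → disjointᵇ A (∁ (A ∪ H)) ≡ true
disjointᵇ-∁∪ˡ []          []      = refl
disjointᵇ-∁∪ˡ (true ∷ A)  (_ ∷ H) = disjointᵇ-∁∪ˡ A H
disjointᵇ-∁∪ˡ (false ∷ A) (_ ∷ H) = disjointᵇ-∁∪ˡ A H

disjointᵇ-∁∪ʳ : (A H : Subset n) → disjointᵇ (∁ (A ∪ H)) H ≡ true
disjointᵇ-∁∪ʳ []          []          = refl
disjointᵇ-∁∪ʳ (true ∷ A)  (_ ∷ H)     = disjointᵇ-∁∪ʳ A H
disjointᵇ-∁∪ʳ (false ∷ A) (true ∷ H)  = disjointᵇ-∁∪ʳ A H
disjointᵇ-∁∪ʳ (false ∷ A) (false ∷ H) = disjointᵇ-∁∪ʳ A H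

coverᵇ-∁∪ : (A H : Subset n) → coverᵇ A (∁ (A ∪ H)) H ≡ true
coverᵇ-∁∪ []          []          = refl
coverᵇ-∁∪ (true ∷ A)  (_ ∷ H)     = coverᵇ-∁∪ A H
coverᵇ-∁∪ (false ∷ A) (true ∷ H)  = coverᵇ-∁∪ A H
coverᵇ-∁∪ (false ∷ A) (false ∷ H) = coverᵇ-∁∪ A H

∣A∣+∣∁∪∣+∣H∣≡n : (A H : Subset n) → disjointᵇ A H ≡ true → ∣ A ∣ + ∣ ∁ (A ∪ H) ∣ + ∣ H ∣ ≡ n
∣A∣+∣∁∪∣+∣H∣≡n []          []          _ = refl
∣A∣+∣∁∪∣+∣H∣≡n (true ∷ A)  (false ∷ H) d = cong suc (∣A∣+∣∁∪∣+∣H∣≡n A H d)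
∣A∣+∣∁∪∣+∣H∣≡n (false ∷ A) (true ∷ H)  d =
  trans (ℕ.+-suc (∣ A ∣ + ∣ ∁ (A ∪ H) ∣) ∣ H ∣) (cong suc (∣A∣+∣∁∪∣+∣H∣≡n A H d))
∣A∣+∣∁∪∣+∣H∣≡n (false ∷ A) (false ∷ H) d =
  trans (cong (_+ ∣ H ∣) (ℕ.+-suc ∣ A ∣ ∣ ∁ (A ∪ H) ∣)) (cong suc (∣A∣+∣∁∪∣+∣H∣≡n A H d))

isDealᵇ-withHand : ∀ {n} a b c (A B H : Subset n) → ∣ H ∣ ≡ c → a + b + c ≡ n →
  isDealᵇ a b c (A , B , H) ≡ (B =ˢ ∁ (A ∪ H)) ∧ ((∣ A ∣ ≡ᵇ a) ∧ disjointᵇ A H)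
isDealᵇ-withHand {n} a b c A B H ∣H∣≡c a+b+c≡n = bool-ext deal⇒ ⇒deal
  where
  deal⇒ : isDealᵇ a b c (A , B , H) ≡ true → (B =ˢ ∁ (A ∪ H)) ∧ ((∣ A ∣ ≡ᵇ a) ∧ disjointᵇ A H) ≡ true
  deal⇒ e =
    let ∣A∣≡a , e₁ = ∧-≡-true (∣ A ∣ ≡ᵇ a) e
        _ , e₂     = ∧-≡-true (∣ B ∣ ≡ᵇ b) e₁
        _ , e₃     = ∧-≡-true (∣ H ∣ ≡ᵇ c) e₂
        dAB , e₄   = ∧-≡-true (disjointᵇ A B) e₃
        dAH , e₅   = ∧-≡-true (disjointᵇ A H) e₄
        dBH , cov  = ∧-≡-true (disjointᵇ B H) e₅
    in cong₂ _∧_ (subst (λ X → X =ˢ ∁ (A ∪ H) ≡ true) (sym (partition⇒≡∁∪ A B H dAB dBH cov))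
                        (=ˢ-refl (∁ (A ∪ H))))
                 (cong₂ _∧_ ∣A∣≡a dAH)
  ⇒deal : (B =ˢ ∁ (A ∪ H)) ∧ ((∣ A ∣ ≡ᵇ a) ∧ disjointᵇ A H) ≡ true → isDealᵇ a b c (A , B , H) ≡ true
  ⇒deal e with B=∁ , e₁ ← ∧-≡-true (B =ˢ ∁ (A ∪ H)) e | =ˢ⇒≡ B (∁ (A ∪ H)) B=∁
  ... | refl =
    cong₂ _∧_ ∣A∣≡a (cong₂ _∧_ (≡⇒≡ᵇ-true ∣∁∪∣≡b) (cong₂ _∧_ (≡⇒≡ᵇ-true ∣H∣≡c)
      (cong₂ _∧_ (disjointᵇ-∁∪ˡ A H) (cong₂ _∧_ dAH (cong₂ _∧_ (disjointᵇ-∁∪ʳ A H) (coverᵇ-∁∪ A H))))))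
    where
    ∣A∣≡a = proj₁ (∧-≡-true (∣ A ∣ ≡ᵇ a) e₁)
    dAH = proj₂ (∧-≡-true (∣ A ∣ ≡ᵇ a) e₁)
    ∣∁∪∣≡b : ∣ ∁ (A ∪ H) ∣ ≡ b
    ∣∁∪∣≡b = ℕ.+-cancelˡ-≡ a _ _ (ℕ.+-cancelʳ-≡ c _ _ (begin
      a + ∣ ∁ (A ∪ H) ∣ + c           ≡⟨ cong₂ (λ u v → u + ∣ ∁ (A ∪ H) ∣ + v) (≡ᵇ-true⇒≡ ∣A∣≡a) ∣H∣≡c ⟨
      ∣ A ∣ + ∣ ∁ (A ∪ H) ∣ + ∣ H ∣   ≡⟨ ∣A∣+∣∁∪∣+∣H∣≡n A H dAH ⟩
      n                               ≡⟨ a+b+c≡n ⟨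
      a + b + c                       ∎))
      where open ≡-Reasoning

sumℚ-deals-withHand : ∀ {n} a b c (H : Subset n) → ∣ H ∣ ≡ c → a + b + c ≡ n → (f : Subset n → ℚ) →
  sumℚ (map (λ d → if HC d =ˢ H then f (HA d) else 0ℚ) (deals n a b c))
  ≡ sumℚ (map (λ A → if (∣ A ∣ ≡ᵇ a) ∧ disjointᵇ A H then f A else 0ℚ) (allSubsets n))
sumℚ-deals-withHand {n} a b c H ∣H∣≡c a+b+c≡n f = begin
  sumℚ (map weight (deals n a b c))
    ≡⟨ sumℚ-filter (isDealᵇ a b c) weight triples ⟩
  sumℚ (map (λ d → if isDealᵇ a b c d then weight d else 0ℚ) triples)
    ≡⟨ sumℚ-triples _ 𝕊 𝕊 𝕊 ⟩
  sumℚ (map (λ A → sumℚ (map (λ B →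
    sumℚ (map (λ C → if isDealᵇ a b c (A , B , C) then weight (A , B , C) else 0ℚ) 𝕊)) 𝕊)) 𝕊)
    ≡⟨ sumℚ-cong 𝕊 (λ A → sumℚ-cong 𝕊 (cathyHoldsH A)) ⟩
  sumℚ (map (λ A → sumℚ (map (λ B → if isDealᵇ a b c (A , B , H) then f A else 0ℚ) 𝕊)) 𝕊)
    ≡⟨ sumℚ-cong 𝕊 bobHoldsRest ⟩
  sumℚ (map (λ A → if (∣ A ∣ ≡ᵇ a) ∧ disjointᵇ A H then f A else 0ℚ) 𝕊)
    ∎
  where
  open ≡-Reasoning
  𝕊 = allSubsets n
  weight : Deal n → ℚ
  weight d = if HC d =ˢ H then f (HA d) else 0ℚ
  triples = concatMap (λ A → concatMap (λ B → map (λ C → (A , B , C)) 𝕊) 𝕊) 𝕊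

  cathyHoldsH : ∀ A B → sumℚ (map (λ C → if isDealᵇ a b c (A , B , C) then weight (A , B , C) else 0ℚ) 𝕊)
                        ≡ (if isDealᵇ a b c (A , B , H) then f A else 0ℚ)
  cathyHoldsH A B = trans (sumℚ-cong 𝕊 (λ C → if-swap-then (isDealᵇ a b c (A , B , C)) (C =ˢ H)))
                          (sumℚ-=ˢ n (λ C → if isDealᵇ a b c (A , B , C) then f A else 0ℚ) H)

  bobHoldsRest : ∀ A → sumℚ (map (λ B → if isDealᵇ a b c (A , B , H) then f A else 0ℚ) 𝕊)
                       ≡ (if (∣ A ∣ ≡ᵇ a) ∧ disjointᵇ A H then f A else 0ℚ)
  bobHoldsRest A = trans (sumℚ-cong 𝕊 λ B →
                           trans (cong (λ t → if t then f A else 0ℚ) (isDealᵇ-withHand a b c A B H ∣H∣≡c a+b+c≡n))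
                                 (if-∧ (B =ˢ ∁ (A ∪ H))))
                         (sumℚ-=ˢ n _ (∁ (A ∪ H)))

-- Cathy's posterior on Alice's hand

CondPr-* : ∀ {n a} (b c : ℕ) (S : Strategy n a) (E F : Deal n → Fin (m S) → Bool) →
  Pr b c S F ≢ 0ℚ → CondPr b c S E F ℚ.* Pr b c S F ≡ Pr b c S (λ d j → E d j ∧ F d j)
CondPr-* b c S E F PrF≢0 with Pr b c S F ℚ.≟ 0ℚ
... | yes PrF≡0 = contradiction PrF≡0 PrF≢0
... | no  PrF≢0′ = trans (ℚ.*-assoc PrEF (1/ PrF) PrF) (trans (cong (PrEF ℚ.*_) (ℚ.*-inverseˡ PrF)) (ℚ.*-identityʳ PrEF))
  where
  instance _ = ℚ.≢-nonZero PrF≢0′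
  PrEF = Pr b c S (λ d j → E d j ∧ F d j)
  PrF  = Pr b c S F

equitable⇒γ*p≡1 : ∀ {n a γ} (S : Strategy n a) → Equitable γ S →
  ∀ {A} i → ∣ A ∣ ≡ a → ann S i A ≡ true → toℚ γ ℚ.* p S A i ≡ 1ℚ
equitable⇒γ*p≡1 {γ = γ} S (∣g∣≡γ , uniform) {A} i ∣A∣≡a A∈𝒜ᵢ = begin
  toℚ γ ℚ.* p S A i                                                  ≡⟨ cong (λ k → toℚ k ℚ.* p S A i) (∣g∣≡γ A ∣A∣≡a) ⟨
  toℚ (length (g S A)) ℚ.* p S A i                                   ≡⟨ sumℚ-count (λ j → ann S j A) (p S A i) (allFin (m S)) ⟨
  sumℚ (map (λ j → if ann S j A then p S A i else 0ℚ) (allFin (m S))) ≡⟨ sumℚ-cong (allFin (m S)) uniformOn-g ⟨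
  sumℚ (map (p S A) (allFin (m S)))                                   ≡⟨ p-sum S A ∣A∣≡a ⟩
  1ℚ                                                                  ∎
  where
  open ≡-Reasoning
  uniformOn-g : ∀ j → p S A j ≡ (if ann S j A then p S A i else 0ℚ)
  uniformOn-g j with ann S j A in A∈𝒜ⱼ
  ... | true  = uniform A j i A∈𝒜ⱼ A∈𝒜ᵢ
  ... | false = p-out S A j A∈𝒜ⱼ

if-∧-reorder : ∀ x y z {v w : A} →
  (if x ∧ (y ∧ z) then v else w) ≡ (if y then (if z then (if x then v else w) else w) else w)
if-∧-reorder true  false _     = refl
if-∧-reorder false false _     = refl
if-∧-reorder true  true  false = refl
if-∧-reorder false true  false = refl
if-∧-reorder true  true  true  = refl
if-∧-reorder false true  true  = refl

module Posterior {n a : ℕ} (b c : ℕ) (S : Strategy n a) (i : Fin (m S)) (H : Subset n) where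

  -- conjuncts ordered as in PrIn, whose two events are then instances of this one
  announcedWith : (Subset n → Bool) → Deal n → Fin (m S) → Bool
  announcedWith B d j = B (HA d) ∧ (⌊ j ≟ i ⌋ ∧ (HC d =ˢ H))

  weight : (Subset n → Bool) → Deal n → ℚ
  weight B d = if HC d =ˢ H then (if B (HA d) then p S (HA d) i else 0ℚ) else 0ℚ

  mass : (Subset n → Bool) → ℚ
  mass B = sumℚ (map (weight B) (deals n a b c))

  N : ℕ
  N = length (deals n a b c)

  Pr-announcedWith : ∀ B → Pr b c S (announcedWith B) ≡ uniformWeight N ℚ.* mass B
  Pr-announcedWith B =
    trans (sumℚ-cong (deals n a b c) λ d →
            trans (sumℚ-cong (allFin (m S)) λ j → if-∧-reorder (B (HA d)) ⌊ j ≟ i ⌋ (HC d =ˢ H))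
                  (trans (sumℚ-indicator _ i) (sym (scaled d))))
          (sym (*-distribˡ-sumℚ (uniformWeight N) (weight B) (deals n a b c)))
    where
    w = uniformWeight N
    scaled : ∀ d → w ℚ.* weight B d ≡ (if HC d =ˢ H then (if B (HA d) then w ℚ.* p S (HA d) i else 0ℚ) else 0ℚ)
    scaled d = trans (*-if-0 w (HC d =ˢ H)) (cong (λ v → if HC d =ˢ H then v else 0ℚ) (*-if-0 w (B (HA d))))

  module _ {γ : ℕ} (equitable : Equitable γ S) (∣H∣≡c : ∣ H ∣ ≡ c) (a+b+c≡n : a + b + c ≡ n) where

    γ*mass : ∀ B → toℚ γ ℚ.* mass B ≡ toℚ (length (filter (λ A → B A ≟ᵇ true) (𝒫 S H i)))
    γ*mass B = begin
      toℚ γ ℚ.* mass B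
        ≡⟨ cong (toℚ γ ℚ.*_) (sumℚ-deals-withHand a b c H ∣H∣≡c a+b+c≡n φ) ⟩
      toℚ γ ℚ.* sumℚ (map (λ A → if (∣ A ∣ ≡ᵇ a) ∧ disjointᵇ A H then φ A else 0ℚ) 𝕊)
        ≡⟨ *-distribˡ-sumℚ (toℚ γ) _ 𝕊 ⟩
      sumℚ (map (λ A → toℚ γ ℚ.* (if (∣ A ∣ ≡ᵇ a) ∧ disjointᵇ A H then φ A else 0ℚ)) 𝕊)
        ≡⟨ sumℚ-cong 𝕊 onHand ⟩
      sumℚ (map (λ A → if ann S i A ∧ disjointᵇ A H then (if B A then 1ℚ else 0ℚ) else 0ℚ) 𝕊)
        ≡⟨ sumℚ-filter (λ A → ann S i A ∧ disjointᵇ A H) (λ A → if B A then 1ℚ else 0ℚ) 𝕊 ⟨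
      sumℚ (map (λ A → if B A then 1ℚ else 0ℚ) (𝒫 S H i))
        ≡⟨ sumℚ-count B 1ℚ (𝒫 S H i) ⟩
      toℚ (length (filter (λ A → B A ≟ᵇ true) (𝒫 S H i))) ℚ.* 1ℚ
        ≡⟨ ℚ.*-identityʳ _ ⟩
      toℚ (length (filter (λ A → B A ≟ᵇ true) (𝒫 S H i)))
        ∎
      where
      open ≡-Reasoning
      𝕊 = allSubsets n
      φ : Subset n → ℚ
      φ A = if B A then p S A i else 0ℚ
      onHand : ∀ A → toℚ γ ℚ.* (if (∣ A ∣ ≡ᵇ a) ∧ disjointᵇ A H then φ A else 0ℚ)
                     ≡ (if ann S i A ∧ disjointᵇ A H then (if B A then 1ℚ else 0ℚ) else 0ℚ)
      -- outside 𝒜ᵢ Alice never announces i; inside it |A| = a, and γ · p_A(i) = 1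
      onHand A with ann S i A in A∈𝒜ᵢ
      ... | false rewrite p-out S A i A∈𝒜ᵢ =
        trans (cong (toℚ γ ℚ.*_) (trans (cong (λ v → if (∣ A ∣ ≡ᵇ a) ∧ disjointᵇ A H then v else 0ℚ) (if-eta (B A)))
                                        (if-eta ((∣ A ∣ ≡ᵇ a) ∧ disjointᵇ A H))))
              (ℚ.*-zeroʳ (toℚ γ))
      ... | true rewrite ≡⇒≡ᵇ-true (ann-⊆ S i A A∈𝒜ᵢ) =
        trans (*-if-0 (toℚ γ) (disjointᵇ A H)) (cong (λ v → if disjointᵇ A H then v else 0ℚ)
          (trans (*-if-0 (toℚ γ) (B A)) (cong (λ v → if B A then v else 0ℚ)
            (equitable⇒γ*p≡1 S equitable i (ann-⊆ S i A A∈𝒜ᵢ) A∈𝒜ᵢ))))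

    PrIn*∣𝒫∣≡count : ∀ x → 𝒫 S H i ≢ [] → PrIn b c S i H x ℚ.* toℚ (length (𝒫 S H i)) ≡ toℚ (count𝒫 S H i x)
    PrIn*∣𝒫∣≡count x 𝒫≢[] = begin
      q ℚ.* toℚ L                    ≡⟨ cong (q ℚ.*_) γ*mass-all ⟨
      q ℚ.* (toℚ γ ℚ.* mass all)     ≡⟨ x∙yz≈y∙xz q (toℚ γ) (mass all) ⟩
      toℚ γ ℚ.* (q ℚ.* mass all)     ≡⟨ cong (toℚ γ ℚ.*_) posterior ⟩
      toℚ γ ℚ.* mass (x ∈ᵇ_)         ≡⟨ γ*mass (x ∈ᵇ_) ⟩
      toℚ (count𝒫 S H i x)           ∎
      where
      open ≡-Reasoning
      q = PrIn b c S i H x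
      L = length (𝒫 S H i)
      all : Subset n → Bool
      all _ = true
      instance
        L≢0 : NonZero L
        L≢0 = ≢[]⇒length-nonZero 𝒫≢[]
        L>0 : Positive (toℚ L)
        L>0 = toℚ-pos L

      γ*mass-all : toℚ γ ℚ.* mass all ≡ toℚ L
      γ*mass-all = trans (γ*mass all) (cong (λ xs → toℚ (length xs))
                     (List.filter-all (λ _ → true ≟ᵇ true) (All.universal (λ _ → refl) (𝒫 S H i))))

      mass-all≢0 : mass all ≢ 0ℚ
      mass-all≢0 mass≡0 = ℚ.<⇒≢ (ℚ.positive⁻¹ (toℚ L))
        (trans (sym (ℚ.*-zeroʳ (toℚ γ))) (trans (cong (toℚ γ ℚ.*_) (sym mass≡0)) γ*mass-all))

      instance
        N≢0 : NonZero N
        N≢0 = ≢[]⇒length-nonZero {xs = deals n a b c}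
                (λ deals≡[] → mass-all≢0 (cong (λ ds → sumℚ (map (weight all) ds)) deals≡[]))
        w>0 : Positive (uniformWeight N)
        w>0 = uniformWeight-pos N
      w = uniformWeight N

      Pr-all≢0 : Pr b c S (announcedWith all) ≢ 0ℚ
      Pr-all≢0 Pr≡0 = mass-all≢0 (*-cancelˡ-pos w (trans (sym (Pr-announcedWith all)) (trans Pr≡0 (sym (ℚ.*-zeroʳ w)))))

      posterior : q ℚ.* mass all ≡ mass (x ∈ᵇ_)
      posterior = *-cancelˡ-pos w (begin
        w ℚ.* (q ℚ.* mass all)                   ≡⟨ x∙yz≈y∙xz w q (mass all) ⟩
        q ℚ.* (w ℚ.* mass all)                   ≡⟨ cong (q ℚ.*_) (Pr-announcedWith all) ⟨
        q ℚ.* Pr b c S (announcedWith all)       ≡⟨ CondPr-* b c S (λ d j → x ∈ᵇ HA d) (announcedWith all) Pr-all≢0 ⟩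
        Pr b c S (announcedWith (x ∈ᵇ_))         ≡⟨ Pr-announcedWith (x ∈ᵇ_) ⟩
        w ℚ.* mass (x ∈ᵇ_)                       ∎)

-- Both criteria from PrIn · |𝒫| = count

weak⇔ : ∀ q k l .{{_ : NonZero l}} → q ℚ.* toℚ l ≡ toℚ k →
  ((0ℚ ℚ.< q) × (q ℚ.< 1ℚ)) ⇔ ((1 ≤ k) × (k ≤ l ∸ 1))
weak⇔ q k (suc l) q*l≡k = mk⇔
  (λ (0<q , q<1) →
      Equivalence.to toℚ-<⇔ (subst₂ ℚ._<_ (ℚ.*-zeroˡ r) q*l≡k (ℚ.*-monoˡ-<-pos r 0<q))
    , ℕ.≤-pred (Equivalence.to toℚ-<⇔ (subst₂ ℚ._<_ q*l≡k (ℚ.*-identityˡ r) (ℚ.*-monoˡ-<-pos r q<1))))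
  (λ (1≤k , k≤l) →
      ℚ.*-cancelʳ-<-nonNeg r (subst₂ ℚ._<_ (sym (ℚ.*-zeroˡ r)) (sym q*l≡k) (Equivalence.from toℚ-<⇔ 1≤k))
    , ℚ.*-cancelʳ-<-nonNeg r (subst₂ ℚ._<_ (sym q*l≡k) (sym (ℚ.*-identityˡ r)) (Equivalence.from toℚ-<⇔ (s≤s k≤l))))
  where
  r = toℚ (suc l)
  instance
    r>0 : Positive r
    r>0 = toℚ-pos (suc l)
    r≥0 : ℚ.NonNegative r
    r≥0 = ℚ.pos⇒nonNeg r

perfect⇔ : ∀ q k l a s .{{_ : NonZero l}} → q ℚ.* toℚ l ≡ toℚ k →
  (q ≡ frac a s) ⇔ (toℚ k ≡ frac (a * l) s)
perfect⇔ q k l a s q*l≡k = mk⇔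
  (λ q≡a/s → trans (sym q*l≡k) (trans (cong (ℚ._* toℚ l) q≡a/s) (sym (frac-* a s l))))
  (λ k≡al/s → *-cancelʳ-pos (toℚ l) (trans q*l≡k (trans k≡al/s (frac-* a s l))))
  where
  instance
    l>0 : Positive (toℚ l)
    l>0 = toℚ-pos l

⇔-forHands : ∀ {n a} c (S : Strategy n a) {Φ Ψ : Fin (m S) → Subset n → Fin n → Set} →
  (∀ {i H} x → ∣ H ∣ ≡ c → 𝒫 S H i ≢ [] → Φ i H x ⇔ Ψ i H x) →
  (∀ i H → ∣ H ∣ ≡ c → 𝒫 S H i ≢ [] → ∀ x → x ∉ H → Φ i H x) ⇔
  (∀ i H → ∣ H ∣ ≡ c → 𝒫 S H i ≢ [] → ∀ x → x ∉ H → Ψ i H x)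
⇔-forHands c S Φ⇔Ψ = mk⇔
  (λ Φ-all i H ∣H∣≡c 𝒫≢[] x x∉H → Equivalence.to   (Φ⇔Ψ x ∣H∣≡c 𝒫≢[]) (Φ-all i H ∣H∣≡c 𝒫≢[] x x∉H))
  (λ Ψ-all i H ∣H∣≡c 𝒫≢[] x x∉H → Equivalence.from (Φ⇔Ψ x ∣H∣≡c 𝒫≢[]) (Ψ-all i H ∣H∣≡c 𝒫≢[] x x∉H))

theorem5 : (n a b c γ : ℕ) → .{{NonZero a}} → .{{NonZero b}} → .{{NonZero c}} →
    a + b + c ≡ n → (S : Strategy n a) → Equitable γ S →
    (Weakly1Secure b c S ⇔
    (∀ (i : Fin (m S)) (H : Subset n) → ∣ H ∣ ≡ c → 𝒫 S H i ≢ [] →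
    ∀ (x : Fin n) → x ∉ H →
    (1 ≤ count𝒫 S H i x) × (count𝒫 S H i x ≤ length (𝒫 S H i) ∸ 1)))
    × (Perfectly1Secure b c S ⇔
    (∀ (i : Fin (m S)) (H : Subset n) → ∣ H ∣ ≡ c → 𝒫 S H i ≢ [] →
    ∀ (x : Fin n) → x ∉ H →
    (+ count𝒫 S H i x) Data.Rational./ 1 ≡ frac (a * length (𝒫 S H i)) (a + b)))
theorem5 n a b c γ a+b+c≡n S equitable =
    ⇔-forHands c S (λ {i} {H} x ∣H∣≡c 𝒫≢[] →
      weak⇔ (PrIn b c S i H x) (count𝒫 S H i x) (length (𝒫 S H i)) {{≢[]⇒length-nonZero 𝒫≢[]}}
        (PrIn*∣𝒫∣≡count x ∣H∣≡c 𝒫≢[]))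
  , ⇔-forHands c S (λ {i} {H} x ∣H∣≡c 𝒫≢[] →
      perfect⇔ (PrIn b c S i H x) (count𝒫 S H i x) (length (𝒫 S H i)) a (a + b) {{≢[]⇒length-nonZero 𝒫≢[]}}
        (PrIn*∣𝒫∣≡count x ∣H∣≡c 𝒫≢[]))
  where
  PrIn*∣𝒫∣≡count : ∀ {i H} x → ∣ H ∣ ≡ c → 𝒫 S H i ≢ [] →
    PrIn b c S i H x ℚ.* toℚ (length (𝒫 S H i)) ≡ toℚ (count𝒫 S H i x)
  PrIn*∣𝒫∣≡count {i} {H} x ∣H∣≡c = Posterior.PrIn*∣𝒫∣≡count b c S i H equitable ∣H∣≡c a+b+c≡n x
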